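{- Let $G$ be a finite graph (multiple edges allowed, no loops) with $\delta(G)\geq 1$, and let $a,b:V(G)\to\mathbb{Z}_{\geq 0}$ be two functions such that $d_G(v)\geq a(v)+b(v)+2w_G(v)-3$ for all $v\in V(G)$. If there exist disjoint non-empty sets $A,B\subseteq V(G)$ with $d_A(v)\geq a(v)$ for all $v\in A$ and $d_B(v)\geq b(v)$ for all $v\in B$, then there exists a partition $(A',B')$ of $V(G)$ into two non-empty sets with $d_{A'}(v)\geq a(v)$ for all $v\in A'$ and $d_{B'}(v)\geq b(v)$ for all $v\in B'$.
   Context: Graphs are finite and undirected, may have multiple edges but no loops. $d_G(v)$ is the number of edges incident with $v$ (counting multiplicities), $\delta(G)$ the minimum degree. For distinct vertices $u,v$, $\mu_G(u,v)$ is the number of edges joining $u$ and $v$, and $w_G(u)=\max_{v\in V(G)\setminus\{u\}}\mu_G(u,v)$. For $X\subseteq V(G)$ and $v\in V(G)$, $d_X(v)$ denotes the degree of $v$ in the induced subgraph $G[X\cup\{v\}]$. -}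

module Defs where

open import Data.Nat using (ℕ; zero; suc; _+_; _⊔_)
open import Data.Fin using (Fin)
open import Data.Fin.Subset using (Subset; _∈_; _∉_; outside; inside)
open import Data.Vec using (lookup)
open import Data.Bool using (if_then_else_)
open import Data.Vec.Functional using (foldr)
open import Relation.Binary.PropositionalEquality using (_≡_)
open import Data.Product using (∃)

-- A finite multigraph (no loops) on vertex set Fin n, given by its
-- edge-multiplicity function μ u v = number of edges joining u and v.
record Multigraph (n : ℕ) : Set where
  field
    μ    : Fin n → Fin n → ℕ
    sym  : ∀ u v → μ u v ≡ μ v u
    loopless : ∀ v → μ v v ≡ 0
open Multigraph public

Σv : ∀ {n} → (Fin n → ℕ) → ℕ
Σv f = foldr _+_ 0 f

deg : ∀ {n} → Multigraph n → Fin n → ℕ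
deg G v = Σv (λ u → μ G v u)

-- d_X(v): degree of v in G[X ∪ {v}] = number of edges from v into X
-- (μ v v = 0, so whether v ∈ X does not matter)
degIn : ∀ {n} → Multigraph n → Subset n → Fin n → ℕ
degIn G X v = Σv (λ u → if lookup X u then μ G v u else 0)

-- w_G(v) = max over u ≠ v of μ(v,u); since μ v v = 0 we may take the max
-- over all u (and the value is 0 when there is no other vertex).
wt : ∀ {n} → Multigraph n → Fin n → ℕ
wt G v = foldr _⊔_ 0 (λ u → μ G v u)

NonEmpty : ∀ {n} → Subset n → Set
NonEmpty X = ∃ λ v → v ∈ X

-- Grow A greedily: while some vertex outside A ∪ B has at least a(v) neighbours
-- in A, add it to A.  The final A' is a-good and every vertex of B' = V ∖ A'
-- outside B has fewer than a(v) neighbours in A', hence, as w(v) ≥ 1 by δ ≥ 1,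
-- at least d(v) − a(v) + 1 ≥ b(v) + 2w(v) − 2 ≥ b(v) neighbours in B'.
-- Vertices of B keep their b-degree because B ⊆ B'.
module Submission where

open import Defs
open import Algebra.Properties.CommutativeMonoid.Sum using (∑-distrib-+; sum-cong-≗)
open import Data.Bool using (true; false; not; if_then_else_)
open import Data.Fin using (Fin; zero; suc)
open import Data.Fin.Properties using (any?)
open import Data.Fin.Subset using (Subset; _∈_; _∉_; _⊆_; _⊂_; _⊃_; _∪_; ⁅_⁆; ∁)
open import Data.Fin.Subset.Induction using (⊃-wellFounded)
open import Data.Fin.Subset.Properties
  using (_∈?_; ⊆-refl; x∈p⇒x∉∁p; x∈∁p⇒x∉p; x∉p⇒x∈∁p; p⊆p∪q; q⊆p∪q; x∈p∪q⁻; x∈⁅x⁆; x∈⁅y⁆⇒x≡y)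
open import Data.Nat using (ℕ; zero; suc; _+_; _*_; _≤_; _<_; _⊔_; z≤n; s≤s; _≤?_)
open import Data.Nat.Properties
open import Data.Nat.Tactic.RingSolver using (solve-∀)
open import Data.Product using (Σ; ∃; _×_; _,_)
open import Data.Sum using (_⊎_; inj₁; inj₂)
open import Data.Vec using (lookup)
open import Data.Vec.Functional using (foldr)
open import Data.Vec.Properties using ([]=⇒lookup; lookup⇒[]=; lookup-map)
open import Function using (_∘_)
open import Induction.WellFounded using (Acc; acc)
open import Relation.Binary.PropositionalEquality using (_≡_; refl; cong; module ≡-Reasoning)
import Relation.Binary.PropositionalEquality as ≡
open import Relation.Nullary using (yes; no)
open import Relation.Nullary.Decidable using (_×-dec_)

Σv-mono : ∀ {n} {f g : Fin n → ℕ} → (∀ i → f i ≤ g i) → Σv f ≤ Σv g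
Σv-mono {zero}  f≤g = z≤n
Σv-mono {suc n} f≤g = +-mono-≤ (f≤g zero) (Σv-mono (f≤g ∘ suc))

1≤Σv⇒1≤max : ∀ {n} (f : Fin n → ℕ) → 1 ≤ Σv f → 1 ≤ foldr _⊔_ 0 f
1≤Σv⇒1≤max {suc n} f 1≤Σf with f zero
... | suc m = ≤-trans (s≤s z≤n) (m≤m⊔n (suc m) (foldr _⊔_ 0 (f ∘ suc)))
... | zero  = ≤-trans (1≤Σv⇒1≤max (f ∘ suc) 1≤Σf) (m≤n⊔m 0 _)

b≤degIn-∁ : ∀ {a b w d dA dC} → a + b + 2 * w ≤ d + 3 → 1 ≤ w →
            dA < a → dA + dC ≡ d → b ≤ dC
b≤degIn-∁ {a} {b} {w} {d} {dA} {dC} deg-cond 1≤w dA<a dA+dC≡d =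
  +-cancelˡ-≤ dA b dC (+-cancelʳ-≤ 3 (dA + b) (dA + dC) (begin
    dA + b + 3           ≡⟨ reshape dA b ⟩
    suc dA + b + 2 * 1   ≤⟨ +-mono-≤ (+-monoˡ-≤ b dA<a) (*-monoʳ-≤ 2 1≤w) ⟩
    a + b + 2 * w        ≤⟨ deg-cond ⟩
    d + 3                ≡⟨ cong (_+ 3) (≡.sym dA+dC≡d) ⟩
    dA + dC + 3          ∎))
  where
  open ≤-Reasoning
  reshape : ∀ x y → x + y + 3 ≡ suc x + y + 2 * 1
  reshape = solve-∀

p⊆∁q⇒q⊆∁p : ∀ {n} {p q : Subset n} → p ⊆ ∁ q → q ⊆ ∁ p
p⊆∁q⇒q⊆∁p p⊆∁q x∈q = x∉p⇒x∈∁p λ x∈p → x∈∁p⇒x∉p (p⊆∁q x∈p) x∈q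

∁-partition : ∀ {n} (p : Subset n) x → (x ∈ p × x ∉ ∁ p) ⊎ (x ∉ p × x ∈ ∁ p)
∁-partition p x with x ∈? p
... | yes x∈p = inj₁ (x∈p , x∈p⇒x∉∁p x∈p)
... | no  x∉p = inj₂ (x∉p , x∉p⇒x∈∁p x∉p)

module _ {n : ℕ} (G : Multigraph n) where

  degIn-mono : ∀ {X Y : Subset n} → X ⊆ Y → ∀ v → degIn G X v ≤ degIn G Y v
  degIn-mono {X} {Y} X⊆Y v = Σv-mono term-mono
    where
    term-mono : ∀ u → (if lookup X u then μ G v u else 0) ≤ (if lookup Y u then μ G v u else 0)
    term-mono u with lookup X u in u∈X
    ... | false = z≤n
    ... | true rewrite []=⇒lookup (X⊆Y (lookup⇒[]= u X u∈X)) = ≤-refl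

  degIn+degIn-∁ : ∀ (X : Subset n) v → degIn G X v + degIn G (∁ X) v ≡ deg G v
  degIn+degIn-∁ X v = begin
    degIn G X v + degIn G (∁ X) v  ≡⟨ ≡.sym (∑-distrib-+ +-0-commutativeMonoid inX in∁X) ⟩
    Σv (λ u → inX u + in∁X u)      ≡⟨ sum-cong-≗ +-0-commutativeMonoid split ⟩
    deg G v                        ∎
    where
    open ≡-Reasoning
    inX in∁X : Fin n → ℕ
    inX  u = if lookup X u then μ G v u else 0
    in∁X u = if lookup (∁ X) u then μ G v u else 0
    split : ∀ u → inX u + in∁X u ≡ μ G v u
    split u rewrite lookup-map u not X with lookup X u
    ... | true  = +-identityʳ _
    ... | false = refl

  1≤wt : ∀ v → 1 ≤ deg G v → 1 ≤ wt G v
  1≤wt v = 1≤Σv⇒1≤max (μ G v)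

  module _ (a : Fin n → ℕ) where

    Good : Subset n → Set
    Good X = ∀ {v} → v ∈ X → a v ≤ degIn G X v

    Saturated : Subset n → Subset n → Set
    Saturated U X = ∀ {v} → v ∈ U → v ∉ X → degIn G X v < a v

    good-∪-⁅⁆ : ∀ {X v} → Good X → a v ≤ degIn G X v → Good (X ∪ ⁅ v ⁆)
    good-∪-⁅⁆ {X} {v} goodX av≤ u∈X∪v with x∈p∪q⁻ X ⁅ v ⁆ u∈X∪v
    ... | inj₁ u∈X = ≤-trans (goodX u∈X) (degIn-mono {X} (p⊆p∪q ⁅ v ⁆) _)
    ... | inj₂ u∈v rewrite x∈⁅y⁆⇒x≡y v u∈v = ≤-trans av≤ (degIn-mono {X} (p⊆p∪q ⁅ v ⁆) _)

    saturate : ∀ (U X : Subset n) → Acc _⊃_ X → X ⊆ U → Good X →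
               ∃ λ Y → X ⊆ Y × Y ⊆ U × Good Y × Saturated U Y
    saturate U X (acc rec) X⊆U goodX
      with any? (λ v → (v ∈? U) ×-dec (v ∈? ∁ X) ×-dec (a v ≤? degIn G X v))
    ... | no stuck = X , ⊆-refl , X⊆U , goodX ,
                     λ v∈U v∉X → ≰⇒> λ av≤ → stuck (_ , v∈U , x∉p⇒x∈∁p v∉X , av≤)
    ... | yes (v , v∈U , v∈∁X , av≤) with saturate U (X ∪ ⁅ v ⁆) (rec X⊂X∪v) X∪v⊆U (good-∪-⁅⁆ goodX av≤)
      where
      X⊂X∪v : X ⊂ X ∪ ⁅ v ⁆
      X⊂X∪v = p⊆p∪q ⁅ v ⁆ , v , q⊆p∪q X ⁅ v ⁆ (x∈⁅x⁆ v) , x∈∁p⇒x∉p v∈∁X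
      X∪v⊆U : X ∪ ⁅ v ⁆ ⊆ U
      X∪v⊆U u∈ with x∈p∪q⁻ X ⁅ v ⁆ u∈
      ... | inj₁ u∈X = X⊆U u∈X
      ... | inj₂ u∈v rewrite x∈⁅y⁆⇒x≡y v u∈v = v∈U
    ...   | Y , X∪v⊆Y , rest = Y , X∪v⊆Y ∘ p⊆p∪q ⁅ v ⁆ , rest

  ∁-saturated-good : ∀ {a b : Fin n → ℕ} →
    (∀ v → 1 ≤ deg G v) → (∀ v → a v + b v + 2 * wt G v ≤ deg G v + 3) →
    ∀ {A B} → A ⊆ ∁ B → Saturated a (∁ B) A → Good b B → Good b (∁ A)
  ∁-saturated-good {a} {b} δ≥1 deg-cond {A} {B} A⊆∁B saturated goodB {v} v∈∁A with v ∈? B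
  ... | yes v∈B = ≤-trans (goodB v∈B) (degIn-mono (p⊆∁q⇒q⊆∁p A⊆∁B) v)
  ... | no  v∉B = b≤degIn-∁ (deg-cond v) (1≤wt v (δ≥1 v))
                    (saturated (x∉p⇒x∈∁p v∉B) (x∈∁p⇒x∉p v∈∁A)) (degIn+degIn-∁ A v)

proposition5 : (n : ℕ) (G : Multigraph n) (a b : Fin n → ℕ) →
    (∀ v → 1 ≤ deg G v) →
    (∀ v → a v + b v + 2 * wt G v ≤ deg G v + 3) →
    (A B : Subset n) →
    (∀ v → v ∈ A → v ∉ B) →
    NonEmpty A → NonEmpty B →
    (∀ v → v ∈ A → a v ≤ degIn G A v) →
    (∀ v → v ∈ B → b v ≤ degIn G B v) →
    Σ (Subset n) λ A' → Σ (Subset n) λ B' →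
    (∀ v → (v ∈ A' × v ∉ B') ⊎ (v ∉ A' × v ∈ B')) ×
    NonEmpty A' × NonEmpty B' ×
    (∀ v → v ∈ A' → a v ≤ degIn G A' v) ×
    (∀ v → v ∈ B' → b v ≤ degIn G B' v)
proposition5 n G a b δ≥1 deg-cond A B A∩B≡∅ (x , x∈A) (y , y∈B) goodA goodB
  with saturate G a (∁ B) A (⊃-wellFounded A) (x∉p⇒x∈∁p ∘ A∩B≡∅ _) (goodA _)
... | A' , A⊆A' , A'⊆∁B , goodA' , saturated =
  A' , ∁ A' , ∁-partition A' , (x , A⊆A' x∈A) , (y , p⊆∁q⇒q⊆∁p A'⊆∁B y∈B) ,
  (λ _ → goodA') , (λ _ → ∁-saturated-good G δ≥1 deg-cond A'⊆∁B saturated (goodB _))
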